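{- For each $G\in\{K_5-e,\ 2\circ K_4\}$ there exists a 2-$(15,4,1)$ packing of size $13$ whose leave contains $G$ as a subgraph.
   Context: A 2-$(15,4,1)$ packing is a pair $(X,\mathcal{A})$ with $|X|=15$ and $\mathcal{A}$ a set of 4-subsets (blocks) of $X$ such that every 2-subset of $X$ lies in at most one block; its size is $|\mathcal{A}|$ and its leave is the graph on $X$ whose edges are the 2-subsets contained in no block. $K_5-e$ is $K_5$ minus one edge; $2\circ K_4$ is two copies of $K_4$ sharing exactly one edge. -}

module Defs where

open import Data.Nat using (ℕ)
open import Data.Fin using (Fin; toℕ)
open import Data.Nat using (_<_; _≤_)
open import Data.List using (List; length; lookup)
open import Data.Product using (Σ; ∃; _×_; ∃-syntax)
open import Data.Sum using (_⊎_)
open import Data.Empty using (⊥)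
open import Relation.Nullary using (¬_)
open import Relation.Binary.PropositionalEquality using (_≡_; _≢_)
open import Function.Definitions using (Injective)

Point : Set
Point = Fin 15

record Block : Set where
  constructor block
  field
    pt  : Fin 4 → Point
    inj : Injective _≡_ _≡_ pt
open Block public

_∈B_ : Point → Block → Set
x ∈B B = ∃[ i ] pt B i ≡ x

PairIn : Point → Point → Block → Set
PairIn x y B = x ∈B B × y ∈B B

-- A 2-(15,4,1) packing: a list of blocks (the list indices are distinct
-- blocks) such that every 2-subset lies in at most one block.
IsPacking : List Block → Set
IsPacking 𝒜 = ∀ (i j : Fin (length 𝒜)) (x y : Point) → x ≢ y →
  PairIn x y (lookup 𝒜 i) → PairIn x y (lookup 𝒜 j) → i ≡ j

LeaveEdge : List Block → Point → Point → Set
LeaveEdge 𝒜 x y = x ≢ y × (∀ (i : Fin (length 𝒜)) → ¬ PairIn x y (lookup 𝒜 i))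

record Graph : Set₁ where
  field
    n    : ℕ
    Edge : Fin n → Fin n → Set
open Graph public

LeaveContains : List Block → Graph → Set
LeaveContains 𝒜 G = Σ (Fin (n G) → Point) λ φ →
  Injective _≡_ _≡_ φ × (∀ u v → Edge G u v → LeaveEdge 𝒜 (φ u) (φ v))

K5-e : Graph
K5-e = record
  { n = 5
  ; Edge = λ u v → (u ≢ v) × ¬ ((toℕ u ≡ 0 × toℕ v ≡ 1) ⊎ (toℕ u ≡ 1 × toℕ v ≡ 0)) }

-- 2∘K4: two K4's on {0,1,2,3} and {2,3,4,5}, sharing exactly the edge {2,3}
twoK4 : Graph
twoK4 = record
  { n = 6
  ; Edge = λ u v → (u ≢ v) ×
      ((toℕ u ≤ 3 × toℕ v ≤ 3) ⊎ (2 ≤ toℕ u × 2 ≤ toℕ v)) }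

-- The theorem is an existence statement about finite objects, so the proof
-- exhibits witnesses and certifies them by proof by reflection:
--   * every property involved (injectivity of a map between finite sets,
--     the packing condition, being an edge of the leave, an embedding of a
--     graph into the leave) is quantified over finite sets only, hence
--     decidable; we build these decision procedures once, in general;
--   * the packing condition is checked in a coordinate form ("two blocks
--     sharing two distinct points, found at some coordinates, are equal"),
--     decidable by exhaustive search over block coordinates, which implies it;
--   * for the two concrete packings PA (leave ⊇ K5-e on {0,...,4}) and
--     PB (leave ⊇ 2∘K4 on {0,...,5}) the decision procedures evaluate to
--     'yes', and 'toWitness' extracts the proofs.
module Submission where

open import Defs
open import Data.Nat using (_≤?_) renaming (_≟_ to _≟ℕ_)
open import Data.Fin using (Fin; toℕ; #_; _↑ˡ_)
open import Data.Fin.Properties using (_≟_; all?; any?)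
open import Data.List using (List; length; lookup; []; _∷_)
open import Data.Vec using ([]; _∷_) renaming (lookup to vlookup)
open import Data.Product using (Σ; _×_; _,_; proj₁; proj₂)
open import Data.Sum using (_⊎_; inj₁; inj₂)
open import Relation.Nullary using (Dec; ¬_; ¬?)
open import Relation.Nullary.Decidable using (True; toWitness; _×-dec_; _⊎-dec_; _→-dec_)
open import Relation.Binary.PropositionalEquality using (_≡_; refl; sym; trans)
open import Function.Definitions using (Injective)

-- Injectivity with explicit arguments: the form in which it is decided.
InjectiveFin : ∀ {m k} → (Fin m → Fin k) → Set
InjectiveFin {m} f = ∀ (i j : Fin m) → f i ≡ f j → i ≡ j

injectiveFin? : ∀ {m k} (f : Fin m → Fin k) → Dec (InjectiveFin f)
injectiveFin? f = all? λ i → all? λ j → (f i ≟ f j) →-dec (i ≟ j)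

injectiveFin⇒injective : ∀ {m k} {f : Fin m → Fin k} → InjectiveFin f → Injective _≡_ _≡_ f
injectiveFin⇒injective inj {i} {j} = inj i j

-- The block {a,b,c,d}; distinctness of the four points is checked by the
-- type checker through the implicit certificate.
⟨_,_,_,_⟩ : (a b c d : Point) → {True (injectiveFin? (vlookup (a ∷ b ∷ c ∷ d ∷ [])))} → Block
⟨ a , b , c , d ⟩ {distinct} =
  block (vlookup (a ∷ b ∷ c ∷ d ∷ [])) (injectiveFin⇒injective (toWitness distinct))

PackingByCoordinates : List Block → Set
PackingByCoordinates 𝒜 = ∀ (i j : Fin (length 𝒜)) (p q r s : Fin 4) →
  pt (lookup 𝒜 i) p ≡ pt (lookup 𝒜 j) r → pt (lookup 𝒜 i) q ≡ pt (lookup 𝒜 j) s →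
  ¬ (pt (lookup 𝒜 i) p ≡ pt (lookup 𝒜 i) q) → i ≡ j

packingByCoordinates? : (𝒜 : List Block) → Dec (PackingByCoordinates 𝒜)
packingByCoordinates? 𝒜 =
  all? λ i → all? λ j → all? λ p → all? λ q → all? λ r → all? λ s →
    (B i p ≟ B j r) →-dec ((B i q ≟ B j s) →-dec (¬? (B i p ≟ B i q) →-dec (i ≟ j)))
  where
  B : Fin (length 𝒜) → Fin 4 → Point
  B i = pt (lookup 𝒜 i)

packingByCoordinates⇒isPacking : (𝒜 : List Block) → PackingByCoordinates 𝒜 → IsPacking 𝒜
packingByCoordinates⇒isPacking 𝒜 packing i j x y x≢y
  ((p , p↦x) , (q , q↦y)) ((r , r↦x) , (s , s↦y)) =
  packing i j p q r s (trans p↦x (sym r↦x)) (trans q↦y (sym s↦y))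
    (λ p≡q → x≢y (trans (sym p↦x) (trans p≡q q↦y)))

pairIn? : (x y : Point) (B : Block) → Dec (PairIn x y B)
pairIn? x y B = any? (λ i → pt B i ≟ x) ×-dec any? (λ i → pt B i ≟ y)

leaveEdge? : (𝒜 : List Block) (x y : Point) → Dec (LeaveEdge 𝒜 x y)
leaveEdge? 𝒜 x y = ¬? (x ≟ y) ×-dec all? (λ i → ¬? (pairIn? x y (lookup 𝒜 i)))

DecidableEdges : Graph → Set
DecidableEdges G = ∀ u v → Dec (Edge G u v)

EmbedsInLeave : List Block → (G : Graph) → (Fin (n G) → Point) → Set
EmbedsInLeave 𝒜 G φ = InjectiveFin φ × (∀ u v → Edge G u v → LeaveEdge 𝒜 (φ u) (φ v))

embedsInLeave? : (𝒜 : List Block) (G : Graph) → DecidableEdges G →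
  (φ : Fin (n G) → Point) → Dec (EmbedsInLeave 𝒜 G φ)
embedsInLeave? 𝒜 G edge? φ =
  injectiveFin? φ ×-dec (all? λ u → all? λ v → edge? u v →-dec leaveEdge? 𝒜 (φ u) (φ v))

embedsInLeave⇒leaveContains : (𝒜 : List Block) (G : Graph) (φ : Fin (n G) → Point) →
  EmbedsInLeave 𝒜 G φ → LeaveContains 𝒜 G
embedsInLeave⇒leaveContains 𝒜 G φ (inj , edges) = φ , injectiveFin⇒injective inj , edges

packingWithLeave : (𝒜 : List Block) (G : Graph) (edge? : DecidableEdges G)
  (φ : Fin (n G) → Point) →
  {True (packingByCoordinates? 𝒜)} → {True (embedsInLeave? 𝒜 G edge? φ)} →
  IsPacking 𝒜 × LeaveContains 𝒜 G
packingWithLeave 𝒜 G edge? φ {packing} {embeds} =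
  packingByCoordinates⇒isPacking 𝒜 (toWitness packing)
  , embedsInLeave⇒leaveContains 𝒜 G φ (toWitness embeds)

K5-e-edge? : DecidableEdges K5-e
K5-e-edge? u v = ¬? (u ≟ v) ×-dec
  ¬? (((toℕ u ≟ℕ 0) ×-dec (toℕ v ≟ℕ 1)) ⊎-dec ((toℕ u ≟ℕ 1) ×-dec (toℕ v ≟ℕ 0)))

twoK4-edge? : DecidableEdges twoK4
twoK4-edge? u v = ¬? (u ≟ v) ×-dec
  (((toℕ u ≤? 3) ×-dec (toℕ v ≤? 3)) ⊎-dec ((2 ≤? toℕ u) ×-dec (2 ≤? toℕ v)))

-- A packing of size 13 in which no block contains two of the points 0,...,4:
-- its leave contains the complete graph on {0,...,4}, in particular K5-e.
PA : List Block
PA = ⟨ # 2 , # 6  , # 7  , # 8  ⟩ ∷ ⟨ # 4 , # 7  , # 9  , # 12 ⟩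
   ∷ ⟨ # 0 , # 10 , # 11 , # 14 ⟩ ∷ ⟨ # 0 , # 5  , # 6  , # 13 ⟩
   ∷ ⟨ # 2 , # 9  , # 10 , # 13 ⟩ ∷ ⟨ # 3 , # 6  , # 10 , # 12 ⟩
   ∷ ⟨ # 3 , # 8  , # 9  , # 14 ⟩ ∷ ⟨ # 8 , # 11 , # 12 , # 13 ⟩
   ∷ ⟨ # 1 , # 5  , # 8  , # 10 ⟩ ∷ ⟨ # 3 , # 5  , # 7  , # 11 ⟩
   ∷ ⟨ # 1 , # 6  , # 9  , # 11 ⟩ ∷ ⟨ # 1 , # 7  , # 13 , # 14 ⟩
   ∷ ⟨ # 2 , # 5  , # 12 , # 14 ⟩ ∷ []

-- A packing of size 13 in which no block contains two of the points 0,...,5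
-- other than {0,4},{0,5},{1,4},{1,5}: its leave contains 2∘K4 on {0,...,5}.
PB : List Block
PB = ⟨ # 3 , # 6  , # 7  , # 8  ⟩ ∷ ⟨ # 0 , # 4  , # 9  , # 10 ⟩
   ∷ ⟨ # 3 , # 10 , # 11 , # 12 ⟩ ∷ ⟨ # 5 , # 6  , # 12 , # 14 ⟩
   ∷ ⟨ # 1 , # 5  , # 9  , # 11 ⟩ ∷ ⟨ # 0 , # 5  , # 8  , # 13 ⟩
   ∷ ⟨ # 2 , # 6  , # 10 , # 13 ⟩ ∷ ⟨ # 1 , # 7  , # 10 , # 14 ⟩
   ∷ ⟨ # 1 , # 4  , # 8  , # 12 ⟩ ∷ ⟨ # 3 , # 9  , # 13 , # 14 ⟩
   ∷ ⟨ # 2 , # 8  , # 11 , # 14 ⟩ ∷ ⟨ # 4 , # 7  , # 11 , # 13 ⟩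
   ∷ ⟨ # 2 , # 7  , # 9  , # 12 ⟩ ∷ []

PA-certified : IsPacking PA × LeaveContains PA K5-e
PA-certified = packingWithLeave PA K5-e K5-e-edge? (_↑ˡ 10)

PB-certified : IsPacking PB × LeaveContains PB twoK4
PB-certified = packingWithLeave PB twoK4 twoK4-edge? (_↑ˡ 9)

lemma5p20 : (G : Graph) → (G ≡ K5-e) ⊎ (G ≡ twoK4) →
    Σ (List Block) (λ 𝒜 → IsPacking 𝒜 × length 𝒜 ≡ 13 × LeaveContains 𝒜 G)
lemma5p20 G (inj₁ refl) = PA , proj₁ PA-certified , refl , proj₂ PA-certified
lemma5p20 G (inj₂ refl) = PB , proj₁ PB-certified , refl , proj₂ PB-certified
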